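{- If $G$ is an $n$-vertex graph with a pendent-edge dismantling ordering of length $k$, then $\mathrm{czf}(G)=n-k$.
   Context: All graphs are finite and simple. A pendent edge is an edge $uv$ at least one of whose endpoints has degree $1$. For an edge $e=uv$, $G-e$ denotes $G$ with $e$ and both endpoints $u,v$ removed. A null graph is a graph with no vertices or no edges. A sequence $(e_1,\dots,e_k)$ of edges of $G$ is a pendent-edge dismantling ordering of length $k$ if, with $G_0=G$ and $G_i=G-\{e_1,\dots,e_i\}$ (removing the edges together with all their endpoints), each $e_i$ is a pendent edge of $G_{i-1}$ for $1\le i\le k$, and $G_k$ is a null graph. Constrained zero forcing: start with a set $S\subseteq V(G)$ of colored vertices, all others uncolored. A colored vertex $c$ may force an uncolored vertex $u$ to become colored if $u$ is the only uncolored neighbor of $c$; only vertices of the initial set $S$ may ever force. $S$ is a constrained zero forcing set if some sequence of forces colors all vertices. $\mathrm{czf}(G)$ is the minimum size of a constrained zero forcing set. -}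

module Defs where

open import Data.Nat using (ℕ; _≤_)
open import Data.Bool using (Bool; true; false; _∧_; not; if_then_else_)
open import Data.Fin using (Fin; _≟_)
open import Data.List using (List; []; _∷_; length; filterᵇ; allFin)
open import Data.Product using (_×_; _,_; Σ)
open import Data.Sum using (_⊎_)
open import Relation.Nullary using (¬_)
open import Relation.Nullary.Decidable using (⌊_⌋)
open import Relation.Binary.PropositionalEquality using (_≡_)

record Graph (n : ℕ) : Set where
  field
    adj    : Fin n → Fin n → Bool
    sym    : ∀ u v → adj u v ≡ adj v u
    irrefl : ∀ u → adj u u ≡ false
open Graph public

count : ∀ {n} → (Fin n → Bool) → ℕ
count {n} P = length (filterᵇ P (allFin n))

-- Pendent-edge dismantling.
-- The current graph G_i is the subgraph of G induced by the vertices
-- still present, given by a predicate  alive : Fin n → Bool.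

deg : ∀ {n} → Graph n → (Fin n → Bool) → Fin n → ℕ
deg G alive u = count (λ w → alive w ∧ adj G u w)

IsEdge : ∀ {n} → Graph n → (Fin n → Bool) → Fin n → Fin n → Set
IsEdge G alive u v = (alive u ≡ true) × (alive v ≡ true) × (adj G u v ≡ true)

Pendent : ∀ {n} → Graph n → (Fin n → Bool) → Fin n → Fin n → Set
Pendent G alive u v = IsEdge G alive u v × ((deg G alive u ≡ 1) ⊎ (deg G alive v ≡ 1))

Null : ∀ {n} → Graph n → (Fin n → Bool) → Set
Null G alive = ∀ u v → ¬ IsEdge G alive u v

removeEnds : ∀ {n} → (Fin n → Bool) → Fin n → Fin n → (Fin n → Bool)
removeEnds alive u v w = alive w ∧ not ⌊ w ≟ u ⌋ ∧ not ⌊ w ≟ v ⌋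

data Dismantle {n} (G : Graph n) : (Fin n → Bool) → List (Fin n × Fin n) → Set where
  done : ∀ {alive} → Null G alive → Dismantle G alive []
  step : ∀ {alive u v es} → Pendent G alive u v →
         Dismantle G (removeEnds alive u v) es →
         Dismantle G alive ((u , v) ∷ es)

PEDO : ∀ {n} → Graph n → List (Fin n × Fin n) → Set
PEDO G es = Dismantle G (λ _ → true) es

colour : ∀ {n} → (Fin n → Bool) → Fin n → (Fin n → Bool)
colour col u w = if ⌊ w ≟ u ⌋ then true else col w

data Forcing {n} (G : Graph n) (S : Fin n → Bool) : (Fin n → Bool) → Set where
  finished : ∀ {col} → (∀ w → col w ≡ true) → Forcing G S col
  force    : ∀ {col} (c u : Fin n) →
             S c ≡ true → col c ≡ true →
             adj G c u ≡ true → col u ≡ false →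
             (∀ w → adj G c w ≡ true → ¬ (w ≡ u) → col w ≡ true) →
             Forcing G S (colour col u) → Forcing G S col

IsCZFS : ∀ {n} → Graph n → (Fin n → Bool) → Set
IsCZFS G S = Forcing G S S

CZF≡ : ∀ {n} → Graph n → ℕ → Set
CZF≡ G m = Σ _ (λ S → IsCZFS G S × count S ≡ m)
         × (∀ S → IsCZFS G S → m ≤ count S)

{-# OPTIONS --safe #-}
-- Orient every edge of the dismantling as (leaf s, stem t), s having degree 1 when it is removed.
-- Colouring all vertices except the k stems gives a constrained zero forcing set: in dismantling
-- order each leaf forces its stem, because its other neighbours were deleted earlier, and so are
-- not stems still waiting to be coloured. Conversely, in any forcing process the initially
-- uncoloured vertices are forced by pairwise distinct neighbours in S, which gives a matching
-- with n - |S| edges; and a matching has at most k edges, because at most one of its edges meets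
-- the removed pendent edge st (any that does contains t) and the others survive into G - st.
module Submission where

open import Defs
open import Data.Nat using (ℕ; _∸_)
open import Data.Fin using (Fin)
open import Data.List using (List; length)
open import Data.Product using (_×_)

open import Data.Bool using (Bool; true; false; _∧_; _∨_; not; if_then_else_)
open import Data.Bool.Properties using (∧-comm; ∧-conicalˡ; ∧-conicalʳ; not-injective; not-¬; ¬-not)
open import Data.Empty using (⊥-elim)
open import Data.Fin using (zero; suc; _≟_)
open import Data.Fin.Properties using (0≢1+n; suc-injective)
open import Data.List using (filterᵇ; tabulate)
open import Data.Nat using (zero; suc; _+_; _≤_; z≤n; s≤s; s≤s⁻¹)
open import Data.Nat.Properties using (≤-trans; ≤-reflexive; m≤n+m; +-suc; +-comm; +-mono-≤; ∸-monoʳ-≤; m+n∸m≡n; m+n∸n≡m; module ≤-Reasoning)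
open import Data.Product using (Σ; ∃; _,_; proj₁; proj₂)
open import Data.Sum using (_⊎_; inj₁; inj₂)
open import Function using (_∘_; id)
open import Relation.Nullary using (yes; no)
open import Relation.Nullary.Decidable using (⌊_⌋; ⌊⌋-map′; isYes≗does; dec-true; dec-false)
open import Relation.Binary.PropositionalEquality as ≡ using (_≡_; _≢_; _≗_; refl; trans; cong; cong₂; subst; module ≡-Reasoning)

bit : Bool → ℕ
bit b = if b then 1 else 0

length-filterᵇ-tabulate : ∀ {n m} (P : Fin m → Bool) (f : Fin n → Fin m) →
                          length (filterᵇ P (tabulate f)) ≡ count (P ∘ f)
length-filterᵇ-tabulate {zero}  P f = refl
length-filterᵇ-tabulate {suc n} P f
  with P (f zero)
     | trans (length-filterᵇ-tabulate P (f ∘ suc)) (≡.sym (length-filterᵇ-tabulate (P ∘ f) suc))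
... | true  | tails = cong suc tails
... | false | tails = tails

count-suc : ∀ {n} (P : Fin (suc n) → Bool) → count P ≡ bit (P zero) + count (P ∘ suc)
count-suc P with P zero
... | true  = cong suc (length-filterᵇ-tabulate P suc)
... | false = length-filterᵇ-tabulate P suc

count-cong : ∀ {n} {P Q : Fin n → Bool} → P ≗ Q → count P ≡ count Q
count-cong {zero}          P≗Q = refl
count-cong {suc n} {P} {Q} P≗Q
  rewrite count-suc P | count-suc Q | P≗Q zero = cong (bit (Q zero) +_) (count-cong (P≗Q ∘ suc))

count-none : ∀ {n} (P : Fin n → Bool) → (∀ w → P w ≡ false) → count P ≡ 0
count-none {zero}  P none = refl
count-none {suc n} P none rewrite count-suc P | none zero = count-none (P ∘ suc) (none ∘ suc)

count-pos : ∀ {n} (P : Fin n → Bool) {w} → P w ≡ true → 1 ≤ count P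
count-pos {suc n} P {zero}  Pw rewrite count-suc P | Pw = s≤s z≤n
count-pos {suc n} P {suc w} Pw rewrite count-suc P = ≤-trans (count-pos (P ∘ suc) Pw) (m≤n+m _ _)

unique⇒count≤1 : ∀ {n} {P : Fin n → Bool} → (∀ a b → P a ≡ true → P b ≡ true → a ≡ b) → count P ≤ 1
unique⇒count≤1 {zero}      unique = z≤n
unique⇒count≤1 {suc n} {P} unique rewrite count-suc P with P zero in P0
... | true  =
  ≤-reflexive (cong suc (count-none (P ∘ suc) (λ w → ¬-not (λ Pw → 0≢1+n (unique _ _ P0 Pw)))))
... | false = unique⇒count≤1 (λ a b Pa Pb → suc-injective (unique _ _ Pa Pb))

count≤1⇒unique : ∀ {n} (P : Fin n → Bool) {a b} → count P ≤ 1 → P a ≡ true → P b ≡ true → a ≡ b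
count≤1⇒unique {suc n} P {zero}  {zero}  _  _  _  = refl
count≤1⇒unique {suc n} P {zero}  {suc b} ≤1 Pa Pb rewrite count-suc P | Pa
  with ≤-trans (count-pos (P ∘ suc) Pb) (s≤s⁻¹ ≤1)
... | ()
count≤1⇒unique {suc n} P {suc a} {zero}  ≤1 Pa Pb = ≡.sym (count≤1⇒unique P ≤1 Pb Pa)
count≤1⇒unique {suc n} P {suc a} {suc b} ≤1 Pa Pb rewrite count-suc P =
  cong suc (count≤1⇒unique (P ∘ suc) (≤-trans (m≤n+m _ _) ≤1) Pa Pb)

count-split : ∀ {n} (P B : Fin n → Bool) →
              count P ≡ count (λ w → P w ∧ B w) + count (λ w → P w ∧ not (B w))
count-split {zero}  P B = refl
count-split {suc n} P B
  rewrite count-suc P | count-suc (λ w → P w ∧ B w) | count-suc (λ w → P w ∧ not (B w))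
  with P zero | B zero | count-split (P ∘ suc) (B ∘ suc)
... | true  | true  | split = cong suc split
... | true  | false | split = trans (cong suc split) (≡.sym (+-suc _ _))
... | false | _     | split = split

count-+-count-not : ∀ {n} (P : Fin n → Bool) → count P + count (not ∘ P) ≡ n
count-+-count-not {zero}  P = refl
count-+-count-not {suc n} P
  rewrite count-suc P | count-suc (not ∘ P)
  with P zero | count-+-count-not (P ∘ suc)
... | true  | split = cong suc split
... | false | split = trans (+-suc _ _) (cong suc split)

count-insert : ∀ {n} (P : Fin n → Bool) {u} → P u ≡ false →
               count (λ w → ⌊ w ≟ u ⌋ ∨ P w) ≡ suc (count P)
count-insert {suc n} P {zero} Pu
  rewrite count-suc (λ w → ⌊ w ≟ zero ⌋ ∨ P w) | count-suc P | Pu = refl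
count-insert {suc n} P {suc u} Pu
  rewrite count-suc (λ w → ⌊ w ≟ suc u ⌋ ∨ P w) | count-suc P = begin
    bit (P zero) + count (λ w → ⌊ suc w ≟ suc u ⌋ ∨ P (suc w))
      ≡⟨ cong (bit (P zero) +_) (count-cong (λ w → cong (_∨ P (suc w)) (⌊⌋-map′ _ _ (w ≟ u)))) ⟩
    bit (P zero) + count (λ w → ⌊ w ≟ u ⌋ ∨ P (suc w))
      ≡⟨ cong (bit (P zero) +_) (count-insert (P ∘ suc) Pu) ⟩
    bit (P zero) + suc (count (P ∘ suc))
      ≡⟨ +-suc _ _ ⟩
    suc (bit (P zero) + count (P ∘ suc)) ∎
  where open ≡-Reasoning

⌊≟⌋-refl : ∀ {n} (x : Fin n) → ⌊ x ≟ x ⌋ ≡ true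
⌊≟⌋-refl x = trans (isYes≗does (x ≟ x)) (dec-true (x ≟ x) refl)

⌊≟⌋-≢ : ∀ {n} {x y : Fin n} → x ≢ y → ⌊ x ≟ y ⌋ ≡ false
⌊≟⌋-≢ {x = x} {y} x≢y = trans (isYes≗does (x ≟ y)) (dec-false (x ≟ y) x≢y)

removeEnds⁻ : ∀ {n} (A : Fin n → Bool) {u v w} →
              removeEnds A u v w ≡ true → A w ≡ true × w ≢ u × w ≢ v
removeEnds⁻ A {u} {v} {w} kept with A w | w ≟ u | w ≟ v
... | true | no w≢u | no w≢v = refl , w≢u , w≢v
removeEnds⁻ A () | false | _       | _
removeEnds⁻ A () | true  | yes _   | _
removeEnds⁻ A () | true  | no _    | yes _

removeEnds-removed : ∀ {n} (A : Fin n → Bool) {u v w} →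
                     A w ≡ true → removeEnds A u v w ≡ false → w ≡ u ⊎ w ≡ v
removeEnds-removed A {u} {v} {w} Aw gone with A w | w ≟ u | w ≟ v
... | _ | yes w≡u | _       = inj₁ w≡u
... | _ | no _    | yes w≡v = inj₂ w≡v
removeEnds-removed A () _  | false | no _ | no _
removeEnds-removed A _  () | true  | no _ | no _

removeEnds-comm : ∀ {n} (A : Fin n → Bool) u v → removeEnds A u v ≗ removeEnds A v u
removeEnds-comm A u v w = cong (A w ∧_) (∧-comm (not ⌊ w ≟ u ⌋) (not ⌊ w ≟ v ⌋))

removeEnds-resp : ∀ {n} {A B : Fin n → Bool} u v → A ≗ B → removeEnds A u v ≗ removeEnds B u v
removeEnds-resp u v A≗B w = cong (_∧ _) (A≗B w)

module _ {n : ℕ} (G : Graph n) where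

  adj⇒≢ : ∀ {u v} → adj G u v ≡ true → u ≢ v
  adj⇒≢ {u} uv refl with trans (≡.sym uv) (irrefl G u)
  ... | ()

  IsEdge-sym : ∀ {A u v} → IsEdge G A u v → IsEdge G A v u
  IsEdge-sym {u = u} {v} (Au , Av , uv) = Av , Au , trans (sym G v u) uv

  IsEdge-resp : ∀ {A B u v} → A ≗ B → IsEdge G A u v → IsEdge G B u v
  IsEdge-resp {u = u} {v} A≗B (Au , Av , uv) = trans (≡.sym (A≗B u)) Au , trans (≡.sym (A≗B v)) Av , uv

  deg-resp : ∀ {A B} → A ≗ B → ∀ s → deg G A s ≡ deg G B s
  deg-resp A≗B s = count-cong (λ w → cong (_∧ adj G s w) (A≗B w))

  leaf-neighbour-unique : ∀ {A s x y} → deg G A s ≡ 1 → IsEdge G A s x → IsEdge G A s y → x ≡ y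
  leaf-neighbour-unique {A} {s} leaf sx sy =
    count≤1⇒unique (λ w → A w ∧ adj G s w) (≤-reflexive leaf) (neighbour sx) (neighbour sy)
    where
    neighbour : ∀ {w} → IsEdge G A s w → A w ∧ adj G s w ≡ true
    neighbour (_ , Aw , sw) rewrite Aw = sw

  removed-edge-hits-stem : ∀ {A s t x y} → deg G A s ≡ 1 → IsEdge G A s t → IsEdge G A x y →
                           removeEnds A s t x ∧ removeEnds A s t y ≡ false → x ≡ t ⊎ y ≡ t
  removed-edge-hits-stem {A} {s} {t} {x} leaf st xy@(Ax , _ , _) gone
    with removeEnds A s t x in x-gone
  ... | false with removeEnds-removed A Ax x-gone
  ...   | inj₁ refl = inj₂ (leaf-neighbour-unique leaf xy st)
  ...   | inj₂ x≡t  = inj₁ x≡t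
  removed-edge-hits-stem {A} leaf st xy@(_ , Ay , _) gone | true with removeEnds-removed A Ay gone
  ...   | inj₁ refl = inj₁ (leaf-neighbour-unique leaf (IsEdge-sym xy) st)
  ...   | inj₂ y≡t  = inj₂ y≡t

  data LeafDismantling : (Fin n → Bool) → ℕ → Set where
    done : ∀ {A} → Null G A → LeafDismantling A 0
    step : ∀ {A s t k} → IsEdge G A s t → deg G A s ≡ 1 →
           LeafDismantling (removeEnds A s t) k → LeafDismantling A (suc k)

  LeafDismantling-resp : ∀ {A B k} → A ≗ B → LeafDismantling A k → LeafDismantling B k
  LeafDismantling-resp A≗B (done null) =
    done (λ u v uv → null u v (IsEdge-resp (≡.sym ∘ A≗B) uv))
  LeafDismantling-resp A≗B (step {s = s} {t} st leaf D) =
    step (IsEdge-resp A≗B st) (trans (≡.sym (deg-resp A≗B s)) leaf)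
         (LeafDismantling-resp (removeEnds-resp s t A≗B) D)

  toLeafDismantling : ∀ {A es} → Dismantle G A es → LeafDismantling A (length es)
  toLeafDismantling (done null)               = done null
  toLeafDismantling (step (uv , inj₁ leaf) D) = step uv leaf (toLeafDismantling D)
  toLeafDismantling {A} (step {u = u} {v} (uv , inj₂ leaf) D) =
    step (IsEdge-sym uv) leaf (LeafDismantling-resp (removeEnds-comm A u v) (toLeafDismantling D))

  stems : ∀ {A k} → LeafDismantling A k → Fin n → Bool
  stems (done _)             w = false
  stems (step {t = t} _ _ D) w = ⌊ w ≟ t ⌋ ∨ stems D w

  stems-alive : ∀ {A k} (D : LeafDismantling A k) {w} → stems D w ≡ true → A w ≡ true
  stems-alive (step {A} {t = t} (_ , At , _) _ D) {w} stem with w ≟ t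
  ... | yes refl = At
  ... | no _     = proj₁ (removeEnds⁻ A (stems-alive D stem))

  stems-removed : ∀ A s t {k} (D : LeafDismantling (removeEnds A s t) k) →
                  stems D s ≡ false × stems D t ≡ false
  stems-removed A s t D =
      ¬-not (λ stem → proj₁ (proj₂ (removeEnds⁻ A (stems-alive D stem))) refl)
    , ¬-not (λ stem → proj₂ (proj₂ (removeEnds⁻ A (stems-alive D stem))) refl)

  count-stems : ∀ {A k} (D : LeafDismantling A k) → count (stems D) ≡ k
  count-stems D@(done _)               = count-none (stems D) (λ _ → refl)
  count-stems (step {A} {s} {t} _ _ D) =
    trans (count-insert (stems D) (proj₂ (stems-removed A s t D))) (cong suc (count-stems D))

  stems-force : ∀ {A k} (D : LeafDismantling A k) {S col} →
                col ≗ not ∘ stems D →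
                (∀ w → A w ≡ true → stems D w ≡ false → S w ≡ true) →
                Forcing G S col
  stems-force (done _) col≗ _ = finished col≗
  stems-force {A} (step {s = s} {t} st@(As , _ , adj-st) leaf D) {S} {col} col≗ S⊇ =
    force s t (S⊇ s As (unstemmed s≢t s-fresh)) (coloured s≢t s-fresh) adj-st t-uncoloured
          (λ w sw w≢t → coloured w≢t (others-fresh sw w≢t))
          (stems-force D colour≗ S⊇′)
    where
    s-fresh : stems D s ≡ false
    s-fresh = proj₁ (stems-removed A s t D)
    s≢t : s ≢ t
    s≢t = adj⇒≢ adj-st
    unstemmed : ∀ {w} → w ≢ t → stems D w ≡ false → stems (step st leaf D) w ≡ false
    unstemmed {w} w≢t fresh = trans (cong (_∨ stems D w) (⌊≟⌋-≢ w≢t)) fresh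
    coloured : ∀ {w} → w ≢ t → stems D w ≡ false → col w ≡ true
    coloured w≢t fresh = trans (col≗ _) (cong not (unstemmed w≢t fresh))
    t-uncoloured : col t ≡ false
    t-uncoloured = trans (col≗ t) (cong (λ b → not (b ∨ stems D t)) (⌊≟⌋-refl t))
    others-fresh : ∀ {w} → adj G s w ≡ true → w ≢ t → stems D w ≡ false
    others-fresh sw w≢t = ¬-not λ stem →
      w≢t (leaf-neighbour-unique leaf (As , proj₁ (removeEnds⁻ A (stems-alive D stem)) , sw) st)
    colour≗ : colour col t ≗ not ∘ stems D
    colour≗ w with w ≟ t
    ... | yes refl = cong not (≡.sym (proj₂ (stems-removed A s t D)))
    ... | no w≢t   = trans (col≗ w) (cong (λ b → not (b ∨ stems D w)) (⌊≟⌋-≢ w≢t))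
    S⊇′ : ∀ w → removeEnds A s t w ≡ true → stems D w ≡ false → S w ≡ true
    S⊇′ w kept fresh with removeEnds⁻ A kept
    ... | Aw , _ , w≢t = S⊇ w Aw (unstemmed w≢t fresh)

  czfs-avoiding-stems : ∀ {k} (D : LeafDismantling (λ _ → true) k) →
                        Σ _ (λ S → IsCZFS G S × count S ≡ n ∸ k)
  czfs-avoiding-stems {k} D = not ∘ stems D , stems-force D (λ _ → refl) (λ _ _ → cong not) , size
    where
    size : count (not ∘ stems D) ≡ n ∸ k
    size = begin
      count (not ∘ stems D)
        ≡⟨ m+n∸m≡n (count (stems D)) _ ⟨
      count (stems D) + count (not ∘ stems D) ∸ count (stems D)
        ≡⟨ cong₂ _∸_ (count-+-count-not (stems D)) (count-stems D) ⟩
      n ∸ k ∎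
      where open ≡-Reasoning

  -- φ w is the vertex that forced w; its value on initially coloured vertices is junk.
  record ForcerMap (S col : Fin n → Bool) (φ : Fin n → Fin n) : Set where
    field
      forcer-∈         : ∀ {w} → col w ≡ false → S (φ w) ≡ true
      forcer-adj       : ∀ {w} → col w ≡ false → adj G (φ w) w ≡ true
      forcer-injective : ∀ {w w′} → col w ≡ false → col w′ ≡ false → φ w ≡ φ w′ → w ≡ w′

  forcers : ∀ {S col} → Forcing G S col → ∃ (ForcerMap S col)
  forcers (finished all) = id , record
    { forcer-∈         = λ {w} uw → ⊥-elim (not-¬ (all w) uw)
    ; forcer-adj       = λ {w} uw → ⊥-elim (not-¬ (all w) uw)
    ; forcer-injective = λ {w} uw → ⊥-elim (not-¬ (all w) uw)
    }
  forcers {S} {col} (force c u Sc _ cu _ only rest) with forcers rest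
  ... | φ , F = φ′ , record
    { forcer-∈         = forcer-∈′
    ; forcer-adj       = forcer-adj′
    ; forcer-injective = forcer-injective′
    }
    where
    open ForcerMap F
    φ′ : Fin n → Fin n
    φ′ w = if ⌊ w ≟ u ⌋ then c else φ w
    still-uncoloured : ∀ {w} → w ≢ u → col w ≡ false → colour col u w ≡ false
    still-uncoloured {w} w≢u uw = trans (cong (λ b → if b then true else col w) (⌊≟⌋-≢ w≢u)) uw
    c-forces-only-u : ∀ {w} → w ≢ u → col w ≡ false → c ≢ φ w
    c-forces-only-u {w} w≢u uw c≡φw =
      not-¬ (only w (subst (λ x → adj G x w ≡ true) (≡.sym c≡φw) (forcer-adj (still-uncoloured w≢u uw)))
                    w≢u)
            uw
    forcer-∈′ : ∀ {w} → col w ≡ false → S (φ′ w) ≡ true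
    forcer-∈′ {w} uw with w ≟ u
    ... | yes _  = Sc
    ... | no w≢u = forcer-∈ (still-uncoloured w≢u uw)
    forcer-adj′ : ∀ {w} → col w ≡ false → adj G (φ′ w) w ≡ true
    forcer-adj′ {w} uw with w ≟ u
    ... | yes refl = cu
    ... | no w≢u   = forcer-adj (still-uncoloured w≢u uw)
    forcer-injective′ : ∀ {w w′} → col w ≡ false → col w′ ≡ false → φ′ w ≡ φ′ w′ → w ≡ w′
    forcer-injective′ {w} {w′} uw uw′ eq with w ≟ u | w′ ≟ u
    ... | yes refl | yes refl = refl
    ... | yes refl | no w′≢u  = ⊥-elim (c-forces-only-u w′≢u uw′ eq)
    ... | no w≢u   | yes refl = ⊥-elim (c-forces-only-u w≢u uw (≡.sym eq))
    ... | no w≢u   | no w′≢u  = forcer-injective (still-uncoloured w≢u uw) (still-uncoloured w′≢u uw′) eq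

  -- The edges w (φ w) with F w form a matching of G[A] with count F edges.
  record Matching (A F : Fin n → Bool) (φ : Fin n → Fin n) : Set where
    field
      edge      : ∀ {w} → F w ≡ true → IsEdge G A w (φ w)
      head-free : ∀ {w} → F w ≡ true → F (φ w) ≡ false
      injective : ∀ {w w′} → F w ≡ true → F w′ ≡ true → φ w ≡ φ w′ → w ≡ w′

    covering-unique : ∀ {t a b} → F a ≡ true → F b ≡ true →
                      a ≡ t ⊎ φ a ≡ t → b ≡ t ⊎ φ b ≡ t → a ≡ b
    covering-unique Fa Fb (inj₁ a≡t)  (inj₁ b≡t)  = trans a≡t (≡.sym b≡t)
    covering-unique Fa Fb (inj₂ φa≡t) (inj₂ φb≡t) = injective Fa Fb (trans φa≡t (≡.sym φb≡t))
    covering-unique Fa Fb (inj₁ a≡t)  (inj₂ φb≡t) =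
      ⊥-elim (not-¬ (subst (λ x → F x ≡ true) (trans a≡t (≡.sym φb≡t)) Fa) (head-free Fb))
    covering-unique Fa Fb (inj₂ φa≡t) (inj₁ b≡t)  =
      ⊥-elim (not-¬ (subst (λ x → F x ≡ true) (trans b≡t (≡.sym φa≡t)) Fb) (head-free Fa))

  matching-bound : ∀ {A F φ k} → LeafDismantling A k → Matching A F φ → count F ≤ k
  matching-bound {F = F} {φ} (done null) M =
    ≤-reflexive (count-none F (λ w → ¬-not (λ Fw → null w (φ w) (Matching.edge M Fw))))
  matching-bound {A} {F} {φ} {suc k} (step {s = s} {t} st leaf D) M = begin
    count F
      ≡⟨ count-split F survives ⟩
    count F′ + count (λ w → F w ∧ not (survives w))
      ≤⟨ +-mono-≤ (matching-bound D M′) (unique⇒count≤1 hitting-stem-unique) ⟩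
    k + 1
      ≡⟨ +-comm k 1 ⟩
    suc k ∎
    where
    open ≤-Reasoning
    open Matching M
    survives : Fin n → Bool
    survives w = removeEnds A s t w ∧ removeEnds A s t (φ w)
    F′ : Fin n → Bool
    F′ w = F w ∧ survives w
    M′ : Matching (removeEnds A s t) F′ φ
    M′ = record
      { edge      = λ {w} F′w → let both = ∧-conicalʳ (F w) _ F′w in
                      ∧-conicalˡ (removeEnds A s t w) _ both , ∧-conicalʳ (removeEnds A s t w) _ both ,
                      proj₂ (proj₂ (edge (∧-conicalˡ _ _ F′w)))
      ; head-free = λ {w} F′w → cong (_∧ survives (φ w)) (head-free (∧-conicalˡ _ _ F′w))
      ; injective = λ F′w F′w′ → injective (∧-conicalˡ _ _ F′w) (∧-conicalˡ _ _ F′w′)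
      }
    hits-stem : ∀ {w} → F w ∧ not (survives w) ≡ true → w ≡ t ⊎ φ w ≡ t
    hits-stem {w} hit =
      removed-edge-hits-stem leaf st (edge (∧-conicalˡ _ _ hit))
                             (not-injective {y = false} (∧-conicalʳ (F w) _ hit))
    hitting-stem-unique : ∀ a b → F a ∧ not (survives a) ≡ true → F b ∧ not (survives b) ≡ true → a ≡ b
    hitting-stem-unique a b hitA hitB =
      covering-unique (∧-conicalˡ _ _ hitA) (∧-conicalˡ _ _ hitB) (hits-stem hitA) (hits-stem hitB)

  czfs-matching : ∀ {S} → IsCZFS G S → ∃ (Matching (λ _ → true) (not ∘ S))
  czfs-matching {S} czfs with forcers czfs
  ... | φ , F = φ , record
    { edge      = λ {w} notS → refl , refl , trans (sym G w (φ w)) (forcer-adj (uncoloured notS))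
    ; head-free = λ notS → cong not (forcer-∈ (uncoloured notS))
    ; injective = λ notS notS′ → forcer-injective (uncoloured notS) (uncoloured notS′)
    }
    where
    open ForcerMap F
    uncoloured : ∀ {w} → not (S w) ≡ true → S w ≡ false
    uncoloured = not-injective {y = false}

  czfs-lower-bound : ∀ {S k} → LeafDismantling (λ _ → true) k → IsCZFS G S → n ∸ k ≤ count S
  czfs-lower-bound {S} {k} D czfs = begin
    n ∸ k
      ≤⟨ ∸-monoʳ-≤ n (matching-bound D (proj₂ (czfs-matching czfs))) ⟩
    n ∸ count (not ∘ S)
      ≡⟨ cong (_∸ count (not ∘ S)) (count-+-count-not S) ⟨
    count S + count (not ∘ S) ∸ count (not ∘ S)
      ≡⟨ m+n∸n≡m (count S) (count (not ∘ S)) ⟩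
    count S ∎
    where open ≤-Reasoning

mainTheorem13 : (n : ℕ) (G : Graph n) (es : List (Fin n × Fin n)) →
                PEDO G es → CZF≡ G (n ∸ length es)
mainTheorem13 n G es pedo = czfs-avoiding-stems G D , λ _ → czfs-lower-bound G D
  where
  D : LeafDismantling G (λ _ → true) (length es)
  D = toLeafDismantling G pedo
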